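{- Let $G$ be the graph of a neighborhood sequence of a non-leaping sequence. If $\{a,b\}\in E(G)$ with $a<b$, then $a$ is adjacent to every vertex $c$ with $a<c<b$.
   Context: A sequence of integers $q_1,\ldots,q_n$ ($n\ge 2$) is non-leaping if $q_1=0$, $q_2=1$, and $2\le q_k\le q_{k-1}+1$ for $k=3,\ldots,n$. Set $b_k=k-q_k+1$ for $k\ge 3$. A neighborhood sequence is $W_1=\varnothing$, $W_2=\{1\}$, and for $k\ge3$, $W_k=\{a_k\}\cup\{b_k,\ldots,k-1\}$ where $a_k\in W_{k-1}$ and $a_k<b_k$. Its graph has vertex set $\{1,\ldots,n\}$ and edges $\{i,k\}$ for $i\in W_k$. -}

module Defs where

open import Data.Nat using (ℕ; zero; suc; _+_; _∸_; _≤_; _<_)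
open import Data.Product using (_×_)
open import Data.Sum using (_⊎_)
open import Data.Empty using (⊥)
open import Relation.Binary.PropositionalEquality using (_≡_)

-- Sequences are total functions ℕ → ℕ; only the indices 1..n matter.

NonLeaping : ℕ → (ℕ → ℕ) → Set
NonLeaping n q =
  q 1 ≡ 0 × q 2 ≡ 1 ×
  (∀ k → 3 ≤ k → k ≤ n → 2 ≤ q k × q k ≤ q (k ∸ 1) + 1)

-- b_k = k - q_k + 1  (q_k ≤ k-1 for non-leaping q, so truncation never occurs)
bseq : (ℕ → ℕ) → ℕ → ℕ
bseq q k = (k + 1) ∸ q k

-- Membership i ∈ W_k, where the sequence a gives the chosen a_k (k ≥ 3).
W : (ℕ → ℕ) → (ℕ → ℕ) → ℕ → ℕ → Set
W q a zero i = ⊥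
W q a (suc zero) i = ⊥
W q a (suc (suc zero)) i = i ≡ 1
W q a k@(suc (suc (suc _))) i = i ≡ a k ⊎ (bseq q k ≤ i × i ≤ k ∸ 1)

IsNeighborhoodSeq : ℕ → (ℕ → ℕ) → (ℕ → ℕ) → Set
IsNeighborhoodSeq n q a =
  ∀ k → 3 ≤ k → k ≤ n → W q a (k ∸ 1) (a k) × a k < bseq q k

EdgeTo : ℕ → (ℕ → ℕ) → (ℕ → ℕ) → ℕ → ℕ → Set
EdgeTo n q a i k = 1 ≤ k × k ≤ n × W q a k i

Adj : ℕ → (ℕ → ℕ) → (ℕ → ℕ) → ℕ → ℕ → Set
Adj n q a u v = EdgeTo n q a u v ⊎ EdgeTo n q a v u

-- Every W_k is contained in {1,…,k-1}, and W_{k+1} ∩ {1,…,k-1} ⊆ W_k: the element a_{k+1} lies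
-- in W_k by definition, and the window [b_{k+1}, k] only moves right, since b_{k+1} ≥ b_k follows
-- from q_{k+1} ≤ q_k + 1. Iterating the second fact from W_b down to W_c shows that a ∈ W_b
-- implies a ∈ W_c for a < c < b, while an edge {a,b} with a < b cannot come from b ∈ W_a.
module Submission where

open import Defs
open import Data.Nat using (ℕ; zero; suc; _+_; _∸_; _≤_; _<_; z≤n; s≤s)
open import Data.Nat.Properties
  using (≤-trans; ≤-pred; <⇒≤; <⇒≱; <-trans; n≤1+n; +-comm; ∸-monoʳ-≤; m≤n⇒m<n∨m≡n)
open import Data.Product using (_,_; proj₁; proj₂)
open import Data.Sum using (inj₁; inj₂)
open import Data.Empty using (⊥-elim)
open import Relation.Binary.PropositionalEquality using (refl; cong; subst)

bseq-≤-suc : (q : ℕ → ℕ) (k : ℕ) → q (suc k) ≤ q k + 1 → bseq q k ≤ bseq q (suc k)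
bseq-≤-suc q k h = subst (_≤ bseq q (suc k)) (cong (suc k + 1 ∸_) (+-comm (q k) 1))
                         (∸-monoʳ-≤ (suc k + 1) h)

W-<-index : ∀ {n q a} → IsNeighborhoodSeq n q a → ∀ {k i} → k ≤ n → W q a k i → i < k
W-<-index ns {suc (suc zero)}        _   refl               = s≤s (s≤s z≤n)
W-<-index ns {k@(suc (suc (suc _)))} k≤n (inj₁ refl)        =
  ≤-trans (W-<-index ns (≤-trans (n≤1+n _) k≤n) (proj₁ (ns k (s≤s (s≤s (s≤s z≤n))) k≤n))) (n≤1+n _)
W-<-index ns {suc (suc (suc _))}     _   (inj₂ (_ , i≤k-1)) = s≤s i≤k-1

module _ {n : ℕ} {q a : ℕ → ℕ} (nl : NonLeaping n q) (ns : IsNeighborhoodSeq n q a) where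

  bseq-≤-suc-within : ∀ {k} → suc k ≤ n → 2 ≤ k → bseq q k ≤ bseq q (suc k)
  bseq-≤-suc-within {k} k+1≤n (s≤s (s≤s _)) =
    bseq-≤-suc q k (proj₂ (proj₂ (proj₂ nl) (suc k) (s≤s (s≤s (s≤s z≤n))) k+1≤n))

  W-suc-restrict : ∀ {k i} → suc k ≤ n → W q a (suc k) i → i < k → W q a k i
  W-suc-restrict {suc zero} _ refl (s≤s ())
  W-suc-restrict {k@(suc (suc _))} k+1≤n (inj₁ refl) _ =
    proj₁ (ns (suc k) (s≤s (s≤s (s≤s z≤n))) k+1≤n)
  W-suc-restrict {2} {i} k+1≤n (inj₂ (b≤i , _)) i<2 = ⊥-elim (<⇒≱ i<2 b₂≤i)
    where
      b₂≤i : 3 ∸ 1 ≤ i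
      b₂≤i = subst (λ t → 3 ∸ t ≤ i) (proj₁ (proj₂ nl))
                   (≤-trans (bseq-≤-suc-within k+1≤n (s≤s (s≤s z≤n))) b≤i)
  W-suc-restrict {suc (suc (suc _))} k+1≤n (inj₂ (b≤i , _)) i<k =
    inj₂ (≤-trans (bseq-≤-suc-within k+1≤n (s≤s (s≤s z≤n))) b≤i , ≤-pred i<k)

  W-restrict : ∀ {y i c} → y ≤ n → W q a y i → i < c → c < y → W q a c i
  W-restrict {suc k} y≤n w i<c (s≤s c≤k) with m≤n⇒m<n∨m≡n c≤k
  ... | inj₂ refl = W-suc-restrict y≤n w i<c
  ... | inj₁ c<k  = W-restrict (≤-trans (n≤1+n k) y≤n) (W-suc-restrict y≤n w (<-trans i<c c<k)) i<c c<k

lemma2p8 : (n : ℕ) → 2 ≤ n → (q : ℕ → ℕ) → NonLeaping n q →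
    (a : ℕ → ℕ) → IsNeighborhoodSeq n q a →
    (x y : ℕ) → x < y → Adj n q a x y →
    (c : ℕ) → x < c → c < y → Adj n q a x c
lemma2p8 n _ q nl a ns x y x<y (inj₁ (_ , y≤n , x∈Wy)) c x<c c<y =
  inj₁ (≤-trans (s≤s z≤n) x<c , ≤-trans (<⇒≤ c<y) y≤n , W-restrict nl ns y≤n x∈Wy x<c c<y)
lemma2p8 n _ q nl a ns x y x<y (inj₂ (_ , x≤n , y∈Wx)) c x<c c<y =
  ⊥-elim (<⇒≱ x<y (<⇒≤ (W-<-index ns x≤n y∈Wx)))
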